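{- Let $G_1$ and $G_2$ be looped simple graphs. The following are equivalent: (1) up to isomorphism, $G_2$ can be obtained from $G_1$ by complementing the loop status of some vertices; (2) there is a compatible isomorphism $\beta:M(IAS(G_1))\to M(IAS(G_2))$ such that $f_\beta(v)\in\{1,(\chi\psi)\}$ for all $v\in V(G_1)$.
   Context: A looped simple graph is a finite graph in which each vertex may carry at most one loop and distinct non-loop edges join distinct pairs of vertices. $A(G)$ is the adjacency matrix over $GF(2)$ (diagonal $1$ iff looped). $M(IAS(G))$ is the binary matroid represented by the columns of $(I\mid A(G)\mid I+A(G))$; its ground set consists of columns $v_\phi,v_\chi,v_\psi$, the columns of $v$ in $I$, $A(G)$, $I+A(G)$. $S_3$ is the permutation group of $\{\phi,\chi,\psi\}$. A compatible isomorphism $\beta$ is a matroid isomorphism mapping each cell $\{v_\phi,v_\chi,v_\psi\}$ onto some cell $\{w_\phi,w_\chi,w_\psi\}$; it induces a bijection $\beta:V(G_1)\to V(G_2)$ and $f_\beta:V(G_1)\to S_3$ with $\beta(v_\iota)=\beta(v)_{f_\beta(v)(\iota)}$. -}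

module Defs where

open import Data.Bool using (Bool; true; false; _∧_; _xor_; not)
open import Data.Nat using (ℕ)
open import Data.Fin using (Fin)
open import Data.Fin.Properties using (_≟_)
open import Data.List using (List; []; _∷_; foldr; map; allFin; cartesianProduct)
open import Data.Product using (_×_; _,_; ∃; proj₁; proj₂)
open import Data.Sum using (_⊎_)
open import Relation.Nullary.Decidable using (⌊_⌋)
open import Relation.Binary.PropositionalEquality using (_≡_; refl)
open import Relation.Nullary using (yes; no)
open import Data.Empty using (⊥-elim)
open import Function using (_∘_)
open import Function.Bundles using (_↔_; _⇔_; Inverse)

-- A looped simple graph on vertex set Fin n, given by its adjacency matrix
-- over GF(2) = Bool (xor as addition); the diagonal entry is 1 iff looped.
record LoopedGraph (n : ℕ) : Set where
  field
    adj : Fin n → Fin n → Bool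
    sym : ∀ u v → adj u v ≡ adj v u
open LoopedGraph public

data Idx : Set where
  φ χ ψ : Idx

allIdx : List Idx
allIdx = φ ∷ χ ∷ ψ ∷ []

-- Ground set of M(IAS(G)): pairs (v , ι) standing for the column v_ι.
Ground : ℕ → Set
Ground n = Fin n × Idx

allGround : (n : ℕ) → List (Ground n)
allGround n = cartesianProduct (allFin n) allIdx

-- Column vectors of the matrix (I | A(G) | I + A(G)) over GF(2).
idCol : ∀ {n} → Fin n → Fin n → Bool
idCol v u = ⌊ u ≟ v ⌋

column : ∀ {n} → LoopedGraph n → Ground n → Fin n → Bool
column G (v , φ) u = idCol v u
column G (v , χ) u = adj G u v
column G (v , ψ) u = idCol v u xor adj G u v

Subset : ℕ → Set
Subset n = Ground n → Bool

_⊆_ : ∀ {n} → Subset n → Subset n → Set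
T ⊆ S = ∀ e → T e ≡ true → S e ≡ true

sumCols : ∀ {n} → LoopedGraph n → Subset n → Fin n → Bool
sumCols {n} G T u = foldr _xor_ false (map (λ e → T e ∧ column G e u) (allGround n))

-- Independent sets of the binary matroid M(IAS(G)): sets of columns that are
-- linearly independent over GF(2), i.e. no nonempty subset sums to zero.
Independent : ∀ {n} → LoopedGraph n → Subset n → Set
Independent G S =
  ∀ T → T ⊆ S → (∀ u → sumCols G T u ≡ false) → ∀ e → T e ≡ false

record MatroidIso {n m : ℕ} (G₁ : LoopedGraph n) (G₂ : LoopedGraph m) : Set where
  field
    β : Ground n ↔ Ground m
    preserves : ∀ (X : Subset n) → Independent G₁ X ⇔ Independent G₂ (X ∘ Inverse.from β)
open MatroidIso public

-- β is compatible and f_β(v) ∈ {1, (χψ)} for all v: β maps the cell of v onto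
-- the cell of some w, with f_β(v) the identity or the transposition (χ ψ).
CompatibleWithFIn1OrChiPsi : ∀ {n m} {G₁ : LoopedGraph n} {G₂ : LoopedGraph m} →
  MatroidIso G₁ G₂ → Set
CompatibleWithFIn1OrChiPsi {n} {m} I = ∀ (v : Fin n) → ∃ λ (w : Fin m) →
  (b (v , φ) ≡ (w , φ)) ×
  ( ((b (v , χ) ≡ (w , χ)) × (b (v , ψ) ≡ (w , ψ)))
  ⊎ ((b (v , χ) ≡ (w , ψ)) × (b (v , ψ) ≡ (w , χ))) )
  where b = Inverse.to (β I)

flipAdj : ∀ {n} → LoopedGraph n → (Fin n → Bool) → Fin n → Fin n → Bool
flipAdj G X u v with u ≟ v
... | yes _ = adj G u v xor X u
... | no _  = adj G u v

flipSym : ∀ {n} (G : LoopedGraph n) (X : Fin n → Bool) → ∀ u v → flipAdj G X u v ≡ flipAdj G X v u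
flipSym G X u v with u ≟ v | v ≟ u
... | yes refl | yes _ = refl
... | yes refl | no ¬p = ⊥-elim (¬p refl)
... | no ¬p | yes refl = ⊥-elim (¬p refl)
... | no _ | no _ = sym G u v

complementLoops : ∀ {n} → LoopedGraph n → (Fin n → Bool) → LoopedGraph n
complementLoops G X = record { adj = flipAdj G X ; sym = flipSym G X }

GraphIso : ∀ {n m} → LoopedGraph n → LoopedGraph m → Set
GraphIso {n} {m} G H = ∃ λ (b : Fin n ↔ Fin m) →
  ∀ u v → adj H (Inverse.to b u) (Inverse.to b v) ≡ adj G u v

-- Complementing the loop at v turns the columns (v_φ, v_χ, v_ψ) = (e_v, A e_v, (I + A) e_v)
-- into (e_v, (I + A) e_v, A e_v). So relabelling the cells along the graph isomorphism and
-- swapping v_χ with v_ψ at the complemented vertices matches the columns of the two matrices up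
-- to a row permutation, and hence is a matroid isomorphism.
-- Conversely, the φ-cells are a basis of identity columns, and for a non-φ cell p the set
-- {p} ∪ {x_φ : x ≠ y} is independent exactly when column p has a 1 in row y. A compatible β
-- with f_β(v) ∈ {1, (χψ)} permutes the φ-cells along its vertex bijection b and sends v_χ to
-- b(v)_χ or b(v)_ψ, whose entries in a row b(u) ≠ b(v) are both the adjacency of b(u) and b(v).
-- So b preserves all adjacencies between distinct vertices, and G₂ is G₁ with the differing
-- loops complemented.
module Submission where

open import Defs hiding (sym)
open import Algebra.Bundles using (CommutativeMonoid; CommutativeRing)
open import Data.Bool using (Bool; true; false; _∧_; _∨_; _xor_; not)
open import Data.Bool.Properties
  using ( xor-∧-commutativeRing; xor-assoc; xor-comm; xor-same; xor-identityʳ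
        ; ∧-zeroʳ; ∧-identityʳ; ∧-distribʳ-xor; ¬-not )
open import Data.Fin using (Fin; zero; suc)
open import Data.Fin.Properties using (_≟_; punchInᵢ≢i)
open import Data.List using (foldr; map; tabulate; cartesianProduct)
open import Data.List.Properties using (map-cong)
open import Data.Nat using (ℕ; zero; suc)
open import Data.Product using (_×_; _,_; ∃; proj₁; proj₂)
open import Data.Product.Properties using (≡-dec)
open import Data.Sum using (_⊎_; inj₁; inj₂)
open import Data.Vec.Functional using (removeAt)
open import Function using (_∘_; id)
open import Function.Bundles using (_↔_; _⇔_; Inverse; Equivalence; mk↔ₛ′; mk⇔)
open import Function.Construct.Composition using (_⇔-∘_)
open import Function.Construct.Symmetry using (⇔-sym)
open import Relation.Binary.Definitions using (DecidableEquality)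
open import Relation.Binary.PropositionalEquality
open import Relation.Nullary using (Dec; yes; no; ¬_; contradiction)
open import Relation.Nullary.Decidable using (⌊_⌋; isYes≗does; dec-true; dec-false)

open CommutativeRing xor-∧-commutativeRing using (+-commutativeMonoid)
open CommutativeMonoid +-commutativeMonoid using (commutativeSemigroup)
open import Algebra.Properties.CommutativeMonoid.Sum +-commutativeMonoid
  using (sum; sum-cong-≗; sum-remove; sum-replicate-zero; ∑-distrib-+; ∑-permute)
open import Algebra.Properties.CommutativeSemigroup commutativeSemigroup using (interchange)

open ≡-Reasoning

variable
  n m : ℕ

⌊⌋-true : ∀ {P : Set} (P? : Dec P) → P → ⌊ P? ⌋ ≡ true
⌊⌋-true P? p = trans (isYes≗does P?) (dec-true P? p)

⌊⌋-false : ∀ {P : Set} (P? : Dec P) → ¬ P → ⌊ P? ⌋ ≡ false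
⌊⌋-false P? ¬p = trans (isYes≗does P?) (dec-false P? ¬p)

⇔-true⇒≡ : ∀ {x y : Bool} → (x ≡ true ⇔ y ≡ true) → x ≡ y
⇔-true⇒≡ {true}          x⇔y = sym (Equivalence.to x⇔y refl)
⇔-true⇒≡ {false} {false} _   = refl
⇔-true⇒≡ {false} {true}  x⇔y = Equivalence.from x⇔y refl

module _ {A B : Set} (_≟A_ : DecidableEquality A) (_≟B_ : DecidableEquality B) (f : A ↔ B) where
  open Inverse f

  ⌊from≟⌋ : ∀ y x → ⌊ from y ≟A x ⌋ ≡ ⌊ y ≟B to x ⌋
  ⌊from≟⌋ y x with y ≟B to x
  ... | yes y≡fx = ⌊⌋-true _ (trans (cong from y≡fx) (strictlyInverseʳ x))
  ... | no y≢fx  = ⌊⌋-false _ (λ fy≡x → y≢fx (trans (sym (strictlyInverseˡ y)) (cong to fy≡x)))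

  ⌊to≟to⌋ : ∀ x x′ → ⌊ to x ≟B to x′ ⌋ ≡ ⌊ x ≟A x′ ⌋
  ⌊to≟to⌋ x x′ = trans (sym (⌊from≟⌋ (to x) x′)) (cong (λ z → ⌊ z ≟A x′ ⌋) (strictlyInverseʳ x))

_≟ᴵ_ : DecidableEquality Idx
φ ≟ᴵ φ = yes refl
χ ≟ᴵ χ = yes refl
ψ ≟ᴵ ψ = yes refl
φ ≟ᴵ χ = no λ ()
φ ≟ᴵ ψ = no λ ()
χ ≟ᴵ φ = no λ ()
χ ≟ᴵ ψ = no λ ()
ψ ≟ᴵ φ = no λ ()
ψ ≟ᴵ χ = no λ ()

_≟ᴳ_ : DecidableEquality (Ground n)
_≟ᴳ_ = ≡-dec _≟_ _≟ᴵ_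

isφ : Idx → Bool
isφ φ = true
isφ χ = false
isφ ψ = false

swapIf : Bool → Idx → Idx
swapIf _     φ = φ
swapIf false χ = χ
swapIf false ψ = ψ
swapIf true  χ = ψ
swapIf true  ψ = χ

swapIf-involutive : ∀ s ι → swapIf s (swapIf s ι) ≡ ι
swapIf-involutive _     φ = refl
swapIf-involutive false χ = refl
swapIf-involutive false ψ = refl
swapIf-involutive true  χ = refl
swapIf-involutive true  ψ = refl

∑ᴵ : (Idx → Bool) → Bool
∑ᴵ f = f φ xor (f χ xor f ψ)

∑ᴵ-zero : ∀ (f : Idx → Bool) → (∀ ι → f ι ≡ false) → ∑ᴵ f ≡ false
∑ᴵ-zero f f≡0 rewrite f≡0 φ | f≡0 χ | f≡0 ψ = refl

∑ᴵ-single : ∀ (f : Idx → Bool) ι → (∀ κ → κ ≢ ι → f κ ≡ false) → ∑ᴵ f ≡ f ι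
∑ᴵ-single f φ off rewrite off χ (λ ()) | off ψ (λ ()) = xor-identityʳ (f φ)
∑ᴵ-single f χ off rewrite off φ (λ ()) | off ψ (λ ()) = xor-identityʳ (f χ)
∑ᴵ-single f ψ off rewrite off φ (λ ()) | off χ (λ ()) = refl

∑ᴵ-xor : ∀ (f g : Idx → Bool) → ∑ᴵ (λ ι → f ι xor g ι) ≡ ∑ᴵ f xor ∑ᴵ g
∑ᴵ-xor f g = trans (cong ((f φ xor g φ) xor_) (interchange (f χ) (g χ) (f ψ) (g ψ)))
                   (interchange (f φ) (g φ) _ _)

∑ᴵ-swapIf : ∀ s (f : Idx → Bool) → ∑ᴵ (f ∘ swapIf s) ≡ ∑ᴵ f
∑ᴵ-swapIf false f = refl
∑ᴵ-swapIf true  f = cong (f φ xor_) (xor-comm (f ψ) (f χ))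

sum-single : ∀ (t : Fin n → Bool) i → (∀ j → j ≢ i → t j ≡ false) → sum t ≡ t i
sum-single {suc n} t i off = begin
  sum t                       ≡⟨ sum-remove {i = i} t ⟩
  t i xor sum (removeAt t i)  ≡⟨ cong (t i xor_) (trans (sum-cong-≗ (λ j → off _ (punchInᵢ≢i i j)))
                                                        (sum-replicate-zero n)) ⟩
  t i xor false               ≡⟨ xor-identityʳ (t i) ⟩
  t i                         ∎

∑ᴳ : (Ground n → Bool) → Bool
∑ᴳ f = sum λ x → ∑ᴵ λ ι → f (x , ι)

∑ᴳ-cong : ∀ {f g : Ground n → Bool} → f ≗ g → ∑ᴳ f ≡ ∑ᴳ g
∑ᴳ-cong f≗g = sum-cong-≗ λ x → cong₂ _xor_ (f≗g (x , φ)) (cong₂ _xor_ (f≗g (x , χ)) (f≗g (x , ψ)))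

∑ᴳ-xor : ∀ (f g : Ground n → Bool) → ∑ᴳ (λ e → f e xor g e) ≡ ∑ᴳ f xor ∑ᴳ g
∑ᴳ-xor f g = trans (sum-cong-≗ λ x → ∑ᴵ-xor (f ∘ (x ,_)) (g ∘ (x ,_)))
                   (∑-distrib-+ (λ x → ∑ᴵ (f ∘ (x ,_))) (λ x → ∑ᴵ (g ∘ (x ,_))))

∑ᴳ-single : ∀ (f : Ground n → Bool) p → (∀ e → e ≢ p → f e ≡ false) → ∑ᴳ f ≡ f p
∑ᴳ-single f (x , ι) off =
  trans (sum-single _ x λ y y≢x → ∑ᴵ-zero _ λ κ → off (y , κ) (y≢x ∘ cong proj₁))
        (∑ᴵ-single _ ι λ κ κ≢ι → off (x , κ) (κ≢ι ∘ cong proj₂))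

foldr-xor-cells : ∀ {k} (f : Ground n → Bool) (h : Fin k → Fin n) →
  foldr _xor_ false (map f (cartesianProduct (tabulate h) allIdx)) ≡ sum λ i → ∑ᴵ λ ι → f (h i , ι)
foldr-xor-cells {k = zero}  f h = refl
foldr-xor-cells {k = suc k} f h = begin
  a xor (b xor (c xor rest))  ≡⟨ cong (λ z → a xor (b xor (c xor z))) (foldr-xor-cells f (h ∘ suc)) ⟩
  a xor (b xor (c xor z))     ≡⟨ cong (a xor_) (xor-assoc b c z) ⟨
  a xor ((b xor c) xor z)     ≡⟨ xor-assoc a (b xor c) z ⟨
  (a xor (b xor c)) xor z     ∎
  where
  a = f (h zero , φ)
  b = f (h zero , χ)
  c = f (h zero , ψ)
  rest = foldr _xor_ false (map f (cartesianProduct (tabulate (h ∘ suc)) allIdx))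
  z = sum λ i → ∑ᴵ λ ι → f (h (suc i) , ι)

sumCols≡∑ᴳ : ∀ (G : LoopedGraph n) T r → sumCols G T r ≡ ∑ᴳ λ e → T e ∧ column G e r
sumCols≡∑ᴳ G T r = foldr-xor-cells (λ e → T e ∧ column G e r) id

sumCols-cong : ∀ (G : LoopedGraph n) {S S′ : Subset n} → S ≗ S′ → ∀ r → sumCols G S r ≡ sumCols G S′ r
sumCols-cong {n} G S≗S′ r =
  cong (foldr _xor_ false) (map-cong (λ e → cong (_∧ column G e r) (S≗S′ e)) (allGround n))

sumCols-xor : ∀ (G : LoopedGraph n) (S S′ : Subset n) r →
  sumCols G (λ e → S e xor S′ e) r ≡ sumCols G S r xor sumCols G S′ r
sumCols-xor G S S′ r = begin
  sumCols G (λ e → S e xor S′ e) r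
    ≡⟨ sumCols≡∑ᴳ G _ r ⟩
  ∑ᴳ (λ e → (S e xor S′ e) ∧ column G e r)
    ≡⟨ ∑ᴳ-cong (λ e → ∧-distribʳ-xor (column G e r) (S e) (S′ e)) ⟩
  ∑ᴳ (λ e → (S e ∧ column G e r) xor (S′ e ∧ column G e r))
    ≡⟨ ∑ᴳ-xor (λ e → S e ∧ column G e r) (λ e → S′ e ∧ column G e r) ⟩
  ∑ᴳ (λ e → S e ∧ column G e r) xor ∑ᴳ (λ e → S′ e ∧ column G e r)
    ≡⟨ cong₂ _xor_ (sumCols≡∑ᴳ G S r) (sumCols≡∑ᴳ G S′ r) ⟨
  sumCols G S r xor sumCols G S′ r
    ∎

-- Independence in M(IAS(G))

⁅_⁆ : Ground n → Subset n
⁅ p ⁆ e = ⌊ e ≟ᴳ p ⌋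

φCells : Subset n
φCells (_ , ι) = isφ ι

sumCols-⁅⁆ : ∀ (G : LoopedGraph n) p r → sumCols G ⁅ p ⁆ r ≡ column G p r
sumCols-⁅⁆ G p r = begin
  sumCols G ⁅ p ⁆ r                   ≡⟨ sumCols≡∑ᴳ G ⁅ p ⁆ r ⟩
  ∑ᴳ (λ e → ⁅ p ⁆ e ∧ column G e r)   ≡⟨ ∑ᴳ-single (λ e → ⁅ p ⁆ e ∧ column G e r) p off ⟩
  ⁅ p ⁆ p ∧ column G p r              ≡⟨ cong (_∧ column G p r) (⌊⌋-true (p ≟ᴳ p) refl) ⟩
  column G p r                        ∎
  where
  off : ∀ e → e ≢ p → ⁅ p ⁆ e ∧ column G e r ≡ false
  off e e≢p = cong (_∧ column G e r) (⌊⌋-false (e ≟ᴳ p) e≢p)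

sumCols-φCells : ∀ (G : LoopedGraph n) (f : Fin n → Bool) r →
  sumCols G (λ e → φCells e ∧ f (proj₁ e)) r ≡ f r
sumCols-φCells G f r = begin
  sumCols G (λ e → φCells e ∧ f (proj₁ e)) r                  ≡⟨ sumCols≡∑ᴳ G _ r ⟩
  ∑ᴳ (λ e → (φCells e ∧ f (proj₁ e)) ∧ column G e r)          ≡⟨ ∑ᴳ-single _ (r , φ) off ⟩
  f r ∧ ⌊ r ≟ r ⌋                                             ≡⟨ cong (f r ∧_) (⌊⌋-true (r ≟ r) refl) ⟩
  f r ∧ true                                                  ≡⟨ ∧-identityʳ (f r) ⟩
  f r                                                         ∎
  where
  off : ∀ e → e ≢ (r , φ) → (φCells e ∧ f (proj₁ e)) ∧ column G e r ≡ false
  off (x , φ) e≢ = trans (cong (f x ∧_) (⌊⌋-false (r ≟ x) (λ r≡x → e≢ (cong (_, φ) (sym r≡x)))))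
                         (∧-zeroʳ (f x))
  off (x , χ) _ = refl
  off (x , ψ) _ = refl

column-φCell : ∀ {G : LoopedGraph n} {e y} → φCells e ≡ true → e ≢ (y , φ) → column G e y ≡ false
column-φCell {e = x , φ} {y} _ e≢ = ⌊⌋-false (y ≟ x) (λ y≡x → e≢ (cong (_, φ) (sym y≡x)))

⊆-false : ∀ {T S : Subset n} → T ⊆ S → ∀ e → S e ≡ false → T e ≡ false
⊆-false {T = T} T⊆S e Se≡false with T e in Te
... | false = refl
... | true  = trans (sym (T⊆S e Te)) Se≡false

Independent-⊆ : ∀ {G : LoopedGraph n} {S S′ : Subset n} → S′ ⊆ S → Independent G S → Independent G S′
Independent-⊆ S′⊆S indS T T⊆S′ = indS T (λ e Te → S′⊆S e (T⊆S′ e Te))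

Independent-cong : ∀ {G : LoopedGraph n} {S S′ : Subset n} → S ≗ S′ → Independent G S ⇔ Independent G S′
Independent-cong S≗S′ = mk⇔ (Independent-⊆ λ e S′e → trans (S≗S′ e) S′e)
                            (Independent-⊆ λ e Se → trans (sym (S≗S′ e)) Se)

zeroSum-pivot : ∀ {G : LoopedGraph n} {T : Subset n} {p r} → (∀ u → sumCols G T u ≡ false) →
  column G p r ≡ true → (∀ e → e ≢ p → T e ∧ column G e r ≡ false) → T p ≡ false
zeroSum-pivot {G = G} {T} {p} {r} T-zero pivot others = begin
  T p                           ≡⟨ ∧-identityʳ (T p) ⟨
  T p ∧ true                    ≡⟨ cong (T p ∧_) pivot ⟨
  T p ∧ column G p r            ≡⟨ ∑ᴳ-single _ p others ⟨
  ∑ᴳ (λ e → T e ∧ column G e r) ≡⟨ sumCols≡∑ᴳ G T r ⟨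
  sumCols G T r                 ≡⟨ T-zero r ⟩
  false                         ∎

φCells-independent : ∀ (G : LoopedGraph n) → Independent G φCells
φCells-independent G T T⊆φ T-zero (x , φ) = zeroSum-pivot T-zero (⌊⌋-true (x ≟ x) refl) others
  where
  others : ∀ e → e ≢ (x , φ) → T e ∧ column G e x ≡ false
  others e e≢ with T e in Te
  ... | false = refl
  ... | true  = column-φCell (T⊆φ e Te) e≢
φCells-independent G T T⊆φ _ (x , χ) = ⊆-false T⊆φ (x , χ) refl
φCells-independent G T T⊆φ _ (x , ψ) = ⊆-false T⊆φ (x , ψ) refl

-- The fundamental circuit of p with respect to the basis φCells of identity columns.
fundamentalCircuit : LoopedGraph n → Ground n → Subset n
fundamentalCircuit G p e = ⁅ p ⁆ e xor (φCells e ∧ column G p (proj₁ e))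

sumCols-fundamentalCircuit : ∀ (G : LoopedGraph n) p r → sumCols G (fundamentalCircuit G p) r ≡ false
sumCols-fundamentalCircuit G p r = begin
  sumCols G (fundamentalCircuit G p) r
    ≡⟨ sumCols-xor G ⁅ p ⁆ (λ e → φCells e ∧ column G p (proj₁ e)) r ⟩
  sumCols G ⁅ p ⁆ r xor sumCols G (λ e → φCells e ∧ column G p (proj₁ e)) r
    ≡⟨ cong₂ _xor_ (sumCols-⁅⁆ G p r) (sumCols-φCells G (column G p) r) ⟩
  column G p r xor column G p r
    ≡⟨ xor-same (column G p r) ⟩
  false
    ∎

probeSet : Ground n → Ground n → Subset n
probeSet p q e = ⁅ p ⁆ e ∨ (φCells e ∧ not (⁅ q ⁆ e))

probeSet-member : ∀ {p q e : Ground n} → probeSet p q e ≡ true → e ≡ p ⊎ (φCells e ≡ true × e ≢ q)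
probeSet-member {p = p} {q} {e} e∈ with e ≟ᴳ p | e ≟ᴳ q
... | yes e≡p | _       = inj₁ e≡p
... | no _    | no e≢q  = inj₂ (trans (sym (∧-identityʳ _)) e∈ , e≢q)
... | no _    | yes _   = contradiction (trans (sym (∧-zeroʳ _)) e∈) λ ()

probeSet-independent : ∀ {G : LoopedGraph n} {p y} →
  column G p y ≡ true → Independent G (probeSet p (y , φ))
probeSet-independent {G = G} {p} {y} pivot T T⊆probe T-zero = φCells-independent G T T⊆φCells T-zero
  where
  others : ∀ e → e ≢ p → T e ∧ column G e y ≡ false
  others e e≢p with T e in Te
  ... | false = refl
  ... | true with probeSet-member {p = p} {y , φ} {e} (T⊆probe e Te)
  ...   | inj₁ e≡p        = contradiction e≡p e≢p
  ...   | inj₂ (e∈φ , e≢) = column-φCell e∈φ e≢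

  T⊆φCells : T ⊆ φCells
  T⊆φCells e Te with probeSet-member {p = p} {y , φ} {e} (T⊆probe e Te)
  ... | inj₁ refl      = contradiction (trans (sym Te) (zeroSum-pivot T-zero pivot others)) λ ()
  ... | inj₂ (e∈φ , _) = e∈φ

probeSet-dependent : ∀ {G : LoopedGraph n} {p y} → φCells p ≡ false → column G p y ≡ false →
  ¬ Independent G (probeSet p (y , φ))
probeSet-dependent {G = G} {p} {y} p∉φ p↾y≡false ind =
  contradiction (ind (fundamentalCircuit G p) circuit⊆probe (sumCols-fundamentalCircuit G p) p) p∈circuit
  where
  p∈circuit : fundamentalCircuit G p p ≢ false
  p∈circuit = subst (_≢ false) (sym p∈circuit≡true) λ ()
    where
    p∈circuit≡true : fundamentalCircuit G p p ≡ true xor (false ∧ column G p (proj₁ p))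
    p∈circuit≡true = cong₂ (λ s t → s xor (t ∧ column G p (proj₁ p))) (⌊⌋-true (p ≟ᴳ p) refl) p∉φ

  circuit⊆probe : fundamentalCircuit G p ⊆ probeSet p (y , φ)
  circuit⊆probe e e∈ with e ≟ᴳ p
  circuit⊆probe e e∈       | yes _ = refl
  circuit⊆probe (x , φ) e∈ | no _  = cong not (⌊⌋-false ((x , φ) ≟ᴳ (y , φ)) x≢y)
    where
    x≢y : (x , φ) ≢ (y , φ)
    x≢y e≡ = contradiction (trans (sym e∈) (trans (cong (column G p ∘ proj₁) e≡) p↾y≡false)) λ ()

probeSet-independent⇔ : ∀ {G : LoopedGraph n} {p y} → φCells p ≡ false →
  Independent G (probeSet p (y , φ)) ⇔ column G p y ≡ true
probeSet-independent⇔ p∉φ =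
  mk⇔ (λ ind → ¬-not λ p↾y≡false → probeSet-dependent p∉φ p↾y≡false ind) probeSet-independent

column-offDiagonal : ∀ (G : LoopedGraph n) {w y κ} →
  φCells (w , κ) ≡ false → y ≢ w → column G (w , κ) y ≡ adj G y w
column-offDiagonal G {κ = χ} _ _   = refl
column-offDiagonal G {w} {y} {ψ} _ y≢w = cong (_xor adj G y w) (⌊⌋-false (y ≟ w) y≢w)

module _ {G : LoopedGraph n} {H : LoopedGraph m} (β : Ground n ↔ Ground m) (ρ : Fin n ↔ Fin m)
  (sumCols-transport : ∀ T r → sumCols H T (Inverse.to ρ r) ≡ sumCols G (T ∘ Inverse.to β) r) where
  open Inverse β

  Independent-transport : ∀ S → Independent G S ⇔ Independent H (S ∘ from)
  Independent-transport S = mk⇔ forward backward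
    where
    forward : Independent G S → Independent H (S ∘ from)
    forward indS T T⊆ T-zero e = begin
      T e             ≡⟨ cong T (strictlyInverseˡ e) ⟨
      T (to (from e)) ≡⟨ indS (T ∘ to) T∘to⊆S (λ r → trans (sym (sumCols-transport T r)) (T-zero _)) (from e) ⟩
      false           ∎
      where
      T∘to⊆S : (T ∘ to) ⊆ S
      T∘to⊆S e′ Te′ = subst (λ z → S z ≡ true) (strictlyInverseʳ e′) (T⊆ (to e′) Te′)

    backward : Independent H (S ∘ from) → Independent G S
    backward indS T T⊆ T-zero e = begin
      T e             ≡⟨ cong T (strictlyInverseʳ e) ⟨
      T (from (to e)) ≡⟨ indS (T ∘ from) (λ e′ → T⊆ (from e′)) T∘from-zero (to e) ⟩
      false           ∎
      where
      T∘from-zero : ∀ y → sumCols H (T ∘ from) y ≡ false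
      T∘from-zero y = begin
        sumCols H (T ∘ from) y              ≡⟨ cong (sumCols H (T ∘ from)) (Inverse.strictlyInverseˡ ρ y) ⟨
        sumCols H (T ∘ from) (ρ→ (ρ← y))    ≡⟨ sumCols-transport (T ∘ from) (ρ← y) ⟩
        sumCols G (T ∘ from ∘ to) (ρ← y)    ≡⟨ sumCols-cong G (cong T ∘ strictlyInverseʳ) (ρ← y) ⟩
        sumCols G T (ρ← y)                  ≡⟨ T-zero (ρ← y) ⟩
        false                               ∎
        where
        ρ→ = Inverse.to ρ
        ρ← = Inverse.from ρ

relabel : Fin n ↔ Fin m → (Fin n → Bool) → Ground n ↔ Ground m
relabel ρ X = mk↔ₛ′ to′ from′ to∘from from∘to
  where
  open Inverse ρ
  to′ : Ground _ → Ground _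
  to′ (x , ι) = (to x , swapIf (X x) ι)
  from′ : Ground _ → Ground _
  from′ (y , ι) = (from y , swapIf (X (from y)) ι)
  to∘from : ∀ e → to′ (from′ e) ≡ e
  to∘from (y , ι) = cong₂ _,_ (strictlyInverseˡ y) (swapIf-involutive _ ι)
  from∘to : ∀ e → from′ (to′ e) ≡ e
  from∘to (x , ι) rewrite strictlyInverseʳ x = cong (x ,_) (swapIf-involutive (X x) ι)

∑ᴳ-relabel : ∀ (ρ : Fin n ↔ Fin m) X f → ∑ᴳ (f ∘ Inverse.to (relabel ρ X)) ≡ ∑ᴳ f
∑ᴳ-relabel ρ X f = begin
  sum (λ x → ∑ᴵ λ ι → f (Inverse.to ρ x , swapIf (X x) ι))
    ≡⟨ sum-cong-≗ (λ x → ∑ᴵ-swapIf (X x) (λ ι → f (Inverse.to ρ x , ι))) ⟩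
  sum (λ x → ∑ᴵ λ ι → f (Inverse.to ρ x , ι))
    ≡⟨ ∑-permute (λ y → ∑ᴵ λ ι → f (y , ι)) ρ ⟨
  ∑ᴳ f
    ∎

-- The entry of column w_ι in row y, where d = [y = w] and a = A(G)_{y w}.
cellEntry : Idx → Bool → Bool → Bool
cellEntry φ d a = d
cellEntry χ d a = a
cellEntry ψ d a = d xor a

column-cellEntry : ∀ (G : LoopedGraph n) w ι y → column G (w , ι) y ≡ cellEntry ι ⌊ y ≟ w ⌋ (adj G y w)
column-cellEntry G w φ y = refl
column-cellEntry G w χ y = refl
column-cellEntry G w ψ y = refl

-- Complementing a loop turns A into I + A on the diagonal, which swapping χ and ψ undoes.
cellEntry-swapIf : ∀ s ι d a → cellEntry (swapIf s ι) d (a xor (d ∧ s)) ≡ cellEntry ι d a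
cellEntry-swapIf s     φ d     a     = refl
cellEntry-swapIf false χ d     a     = trans (cong (a xor_) (∧-zeroʳ d)) (xor-identityʳ a)
cellEntry-swapIf false ψ d     a     = cong (d xor_) (trans (cong (a xor_) (∧-zeroʳ d)) (xor-identityʳ a))
cellEntry-swapIf true  χ false a     = xor-identityʳ a
cellEntry-swapIf true  χ true  false = refl
cellEntry-swapIf true  χ true  true  = refl
cellEntry-swapIf true  ψ false a     = xor-identityʳ a
cellEntry-swapIf true  ψ true  a     = xor-comm a true

flipAdj-xor : ∀ (G : LoopedGraph n) X u v → flipAdj G X u v ≡ adj G u v xor (⌊ u ≟ v ⌋ ∧ X v)
flipAdj-xor G X u v with u ≟ v
... | yes refl = refl
... | no _     = sym (xor-identityʳ (adj G u v))

module LoopComplement {G₁ : LoopedGraph n} {G₂ : LoopedGraph m} (X : Fin n → Bool) (ρ : Fin n ↔ Fin m)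
  (ρ-iso : ∀ u v → adj G₂ (Inverse.to ρ u) (Inverse.to ρ v) ≡ adj (complementLoops G₁ X) u v) where
  open Inverse ρ using (to)

  column-relabel : ∀ e r → column G₂ (Inverse.to (relabel ρ X) e) (to r) ≡ column G₁ e r
  column-relabel (x , ι) r = begin
    column G₂ (to x , swapIf (X x) ι) (to r)
      ≡⟨ column-cellEntry G₂ (to x) (swapIf (X x) ι) (to r) ⟩
    cellEntry (swapIf (X x) ι) ⌊ to r ≟ to x ⌋ (adj G₂ (to r) (to x))
      ≡⟨ cong₂ (cellEntry (swapIf (X x) ι)) (⌊to≟to⌋ _≟_ _≟_ ρ r x)
               (trans (ρ-iso r x) (flipAdj-xor G₁ X r x)) ⟩
    cellEntry (swapIf (X x) ι) ⌊ r ≟ x ⌋ (adj G₁ r x xor (⌊ r ≟ x ⌋ ∧ X x))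
      ≡⟨ cellEntry-swapIf (X x) ι _ _ ⟩
    cellEntry ι ⌊ r ≟ x ⌋ (adj G₁ r x)
      ≡⟨ column-cellEntry G₁ x ι r ⟨
    column G₁ (x , ι) r
      ∎

  sumCols-relabel : ∀ T r → sumCols G₂ T (to r) ≡ sumCols G₁ (T ∘ Inverse.to (relabel ρ X)) r
  sumCols-relabel T r = begin
    sumCols G₂ T (to r)
      ≡⟨ sumCols≡∑ᴳ G₂ T (to r) ⟩
    ∑ᴳ (λ e → T e ∧ column G₂ e (to r))
      ≡⟨ ∑ᴳ-relabel ρ X (λ e → T e ∧ column G₂ e (to r)) ⟨
    ∑ᴳ (λ e → T (β′ e) ∧ column G₂ (β′ e) (to r))
      ≡⟨ ∑ᴳ-cong (λ e → cong (T (β′ e) ∧_) (column-relabel e r)) ⟩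
    ∑ᴳ (λ e → T (β′ e) ∧ column G₁ e r)
      ≡⟨ sumCols≡∑ᴳ G₁ (T ∘ β′) r ⟨
    sumCols G₁ (T ∘ β′) r
      ∎
    where β′ = Inverse.to (relabel ρ X)

  matroidIso : MatroidIso G₁ G₂
  matroidIso = record
    { β         = relabel ρ X
    ; preserves = Independent-transport (relabel ρ X) ρ sumCols-relabel
    }

  compatible : CompatibleWithFIn1OrChiPsi matroidIso
  compatible v with X v
  ... | false = to v , refl , inj₁ (refl , refl)
  ... | true  = to v , refl , inj₂ (refl , refl)

-- Compatible isomorphisms

φCell-η : ∀ (e : Ground n) → φCells e ≡ true → e ≡ (proj₁ e , φ)
φCell-η (x , φ) _ = refl

module CompatibleIso {G₁ : LoopedGraph n} {G₂ : LoopedGraph m}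
  (I : MatroidIso G₁ G₂) (compat : CompatibleWithFIn1OrChiPsi I) where
  open Inverse (β I)

  b : Fin n → Fin m
  b v = proj₁ (compat v)

  to-φ : ∀ x → to (x , φ) ≡ (b x , φ)
  to-φ x = proj₁ (proj₂ (compat x))

  to-χ : ∀ v → ∃ λ κ → φCells (b v , κ) ≡ false × to (v , χ) ≡ (b v , κ)
  to-χ v with proj₂ (proj₂ (compat v))
  ... | inj₁ (χ↦χ , _) = χ , refl , χ↦χ
  ... | inj₂ (χ↦ψ , _) = ψ , refl , χ↦ψ

  φCells-to : ∀ e → φCells (to e) ≡ φCells e
  φCells-to (x , φ) = cong φCells (to-φ x)
  φCells-to (x , χ) with proj₂ (proj₂ (compat x))
  ... | inj₁ (χ↦χ , _) = cong φCells χ↦χ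
  ... | inj₂ (χ↦ψ , _) = cong φCells χ↦ψ
  φCells-to (x , ψ) with proj₂ (proj₂ (compat x))
  ... | inj₁ (_ , ψ↦ψ) = cong φCells ψ↦ψ
  ... | inj₂ (_ , ψ↦χ) = cong φCells ψ↦χ

  φCells-from : ∀ e → φCells (from e) ≡ φCells e
  φCells-from e = trans (sym (φCells-to (from e))) (cong φCells (strictlyInverseˡ e))

  c : Fin m → Fin n
  c w = proj₁ (from (w , φ))

  from-φ : ∀ w → from (w , φ) ≡ (c w , φ)
  from-φ w = φCell-η (from (w , φ)) (φCells-from (w , φ))

  vertexIso : Fin n ↔ Fin m
  vertexIso = mk↔ₛ′ b c b∘c c∘b
    where
    b∘c : ∀ w → b (c w) ≡ w
    b∘c w = cong proj₁ (begin
      (b (c w) , φ)     ≡⟨ to-φ (c w) ⟨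
      to (c w , φ)      ≡⟨ cong to (from-φ w) ⟨
      to (from (w , φ)) ≡⟨ strictlyInverseˡ (w , φ) ⟩
      (w , φ)           ∎)
    c∘b : ∀ v → c (b v) ≡ v
    c∘b v = cong proj₁ (begin
      (c (b v) , φ)     ≡⟨ from-φ (b v) ⟨
      from (b v , φ)    ≡⟨ cong from (to-φ v) ⟨
      from (to (v , φ)) ≡⟨ strictlyInverseʳ (v , φ) ⟩
      (v , φ)           ∎)

  b-injective : ∀ {u v} → b u ≡ b v → u ≡ v
  b-injective {u} {v} bu≡bv = begin
    u          ≡⟨ Inverse.strictlyInverseʳ vertexIso u ⟨
    c (b u)    ≡⟨ cong c bu≡bv ⟩
    c (b v)    ≡⟨ Inverse.strictlyInverseʳ vertexIso v ⟩
    v          ∎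

  probeSet-image : ∀ p q → probeSet p q ∘ from ≗ probeSet (to p) (to q)
  probeSet-image p q e =
    cong₂ _∨_ (⌊from≟⌋ _≟ᴳ_ _≟ᴳ_ (β I) e p)
              (cong₂ (λ s t → s ∧ not t) (φCells-from e) (⌊from≟⌋ _≟ᴳ_ _≟ᴳ_ (β I) e q))

  adj-preserved : ∀ {u v} → u ≢ v → adj G₂ (b u) (b v) ≡ adj G₁ u v
  adj-preserved {u} {v} u≢v with to-χ v
  ... | κ , κ∉φ , v-χ↦ = begin
    adj G₂ (b u) (b v)          ≡⟨ column-offDiagonal G₂ κ∉φ (u≢v ∘ b-injective) ⟨
    column G₂ (b v , κ) (b u)   ≡⟨ ⇔-true⇒≡ entries⇔ ⟩
    column G₁ (v , χ) u         ∎
    where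
    image : probeSet (v , χ) (u , φ) ∘ from ≗ probeSet (b v , κ) (b u , φ)
    image e = trans (probeSet-image (v , χ) (u , φ) e) (cong₂ (λ p q → probeSet p q e) v-χ↦ (to-φ u))
    entries⇔ : column G₂ (b v , κ) (b u) ≡ true ⇔ column G₁ (v , χ) u ≡ true
    entries⇔ = probeSet-independent⇔ refl
           ⇔-∘ (⇔-sym (preserves I (probeSet (v , χ) (u , φ)))
           ⇔-∘ (Independent-cong (sym ∘ image)
           ⇔-∘ ⇔-sym (probeSet-independent⇔ κ∉φ)))

  loopsDiffer : Fin n → Bool
  loopsDiffer v = adj G₁ v v xor adj G₂ (b v) (b v)

  graphIso : GraphIso (complementLoops G₁ loopsDiffer) G₂
  graphIso = vertexIso , adj-complemented
    where
    adj-complemented : ∀ u v → adj G₂ (b u) (b v) ≡ flipAdj G₁ loopsDiffer u v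
    adj-complemented u v with u ≟ v
    ... | yes refl = begin
      adj G₂ (b u) (b u)                        ≡⟨ cong (_xor adj G₂ (b u) (b u)) (xor-same a) ⟨
      (a xor a) xor adj G₂ (b u) (b u)          ≡⟨ xor-assoc a a (adj G₂ (b u) (b u)) ⟩
      a xor (a xor adj G₂ (b u) (b u))          ∎
      where a = adj G₁ u u
    ... | no u≢v   = adj-preserved u≢v

theorem13 : ∀ {n m : ℕ} (G₁ : LoopedGraph n) (G₂ : LoopedGraph m) →
    (∃ λ (X : Fin n → Bool) → GraphIso (complementLoops G₁ X) G₂)
      ⇔ (∃ λ (I : MatroidIso G₁ G₂) → CompatibleWithFIn1OrChiPsi I)
theorem13 G₁ G₂ = mk⇔
  (λ { (X , ρ , ρ-iso) → let open LoopComplement {G₂ = G₂} X ρ ρ-iso in matroidIso , compatible })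
  (λ { (I , compat) → let open CompatibleIso I compat in loopsDiffer , graphIso })
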